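{- Let $k$ and $r$ be positive integers with $k\geq 2$ and $1\leq r<k-1$, let $D$ be the diameter of the Kneser graph $K(2k+r,k)$, and let $p\geq 1$ be an integer with $2p\leq D$. Let $A$ and $B$ be two distinct, non-adjacent vertices of $K_{=2p}(2k+r,k)$, and let $s=|A\cap B|$. Then the distance between $A$ and $B$ in $K_{=2p}(2k+r,k)$ equals \[\max\left\{2,\left\lceil \frac{k-s}{rp}\right\rceil\right\}.\]
   Context: For positive integers $n,k$, $[n]^k$ is the set of $k$-element subsets of $\{1,\dots,n\}$. The Kneser graph $K(2k+r,k)$ has vertex set $[2k+r]^k$, with $A,B$ adjacent iff $A\cap B=\emptyset$; it is connected. For a connected graph $G$ and positive integer $d$, the exact distance-$d$ graph $G_{=d}$ has the same vertex set as $G$, with two vertices adjacent iff their distance (length of a shortest path) in $G$ is exactly $d$. $K_{=d}(2k+r,k)$ denotes the exact distance-$d$ graph of $K(2k+r,k)$; distances in it are shortest-path distances in $K_{=d}(2k+r,k)$. (The diameter of $K(2k+r,k)$ is $\lceil (k-1)/r\rceil+1$.) -}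

module Defs where

open import Data.Nat using (ℕ; zero; suc; _+_; _*_; _<_; _≤_)
open import Data.Nat.DivMod using (_/_)
open import Data.Fin.Subset using (Subset; _∩_; ⊥; ∣_∣)
open import Data.Product using (Σ; _×_; ∃; ∃-syntax; _,_; proj₁)
open import Relation.Binary.PropositionalEquality using (_≡_)
open import Relation.Nullary using (¬_)

Vertex : ℕ → ℕ → Set
Vertex n k = Σ (Subset n) (λ A → ∣ A ∣ ≡ k)

KneserAdj : ∀ {n k} → Vertex n k → Vertex n k → Set
KneserAdj A B = proj₁ A ∩ proj₁ B ≡ ⊥

data Walk {V : Set} (E : V → V → Set) : V → V → ℕ → Set where
  here : ∀ {x} → Walk E x x 0
  step : ∀ {x y z m} → E x y → Walk E y z m → Walk E x z (suc m)

Dist : {V : Set} → (V → V → Set) → V → V → ℕ → Set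
Dist E x y d = Walk E x y d × (∀ m → m < d → ¬ Walk E x y m)

ExactDist : {V : Set} → (V → V → Set) → ℕ → V → V → Set
ExactDist E d x y = Dist E x y d

IsDiameter : {V : Set} → (V → V → Set) → ℕ → Set
IsDiameter {V} E D =
  (∀ (x y : V) → ∃[ d ] (d ≤ D × Dist E x y d)) × (∃[ x ] ∃[ y ] Dist E x y D)

-- Ceiling division ⌈a/b⌉ (for b ≥ 1; value 0 for b = 0, never used).
ceilDiv : ℕ → ℕ → ℕ
ceilDiv a zero = 0
ceilDiv a (suc b) = (a + b) / suc b

-- Write s = |X ∩ Y| and g = |X ─ Y| = k − s for vertices X, Y of K(2k+r,k). A neighbour W of X
-- is disjoint from X, so g(X,Y) ≤ r + s(W,Y) and s(X,Y) ≤ g(W,Y); by induction a walk of length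
-- 2j from X to Y forces g ≤ rj and one of length 2j+1 forces s ≤ rj, and vertices with prescribed
-- intersection sizes show that both conditions are also sufficient. Hence, with q = r(p−1) and
-- M = rp, X and Y are adjacent in the exact distance-2p graph G as soon as q < g ≤ M and q < s,
-- and only if g ≤ M. As g satisfies the triangle inequality, a walk of length m in G forces
-- g ≤ mM, so dist_G(A,B) ≥ ⌈g/M⌉, and dist_G(A,B) ≥ 2 as A, B are distinct and non-adjacent.
-- Conversely, while g > 2M one moves to a vertex C with g(X,C) = M and g(C,Y) = g − M; once
-- g ≤ 2M a vertex C with g(X,C) = g(C,Y) = max(q+1, ⌈g/2⌉) finishes in two steps. This last
-- step needs 2(q+1) ≤ k, which is what a pair of vertices at distance D ≥ 2p provides.

module Submission where

open import Defs
open import Data.Nat using (ℕ; _+_; _*_; _∸_; _≤_; _<_; _⊔_)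
open import Data.Fin.Subset using (_∩_; ∣_∣)
open import Data.Product using (proj₁)
open import Relation.Binary.PropositionalEquality using (_≡_; _≢_)
open import Relation.Nullary using (¬_)

open import Data.Fin.Subset
  using (Subset; inside; outside; _∪_; _─_; ∁; ⊥; _∈_; _∉_; _⊆_)
open import Data.Fin.Subset.Properties
  using ( p⊆q⇒∣p∣≤∣q∣; drop-∷-⊆; ⊥⊆; ∣⊥∣≡0; ∣p∣≤n; ∣∁p∣≡n∸∣p∣; ∣p─q∣≤∣p∣
        ; _∈?_; x∈p∩q⁺; x∈p∩q⁻; x∈p∪q⁺; x∈p∪q⁻; x∈p∧x∉q⇒x∈p─q; p─q⊆p
        ; x∉p⇒x∈∁p; ∉⊥; ∩-comm; ∩-idem; p∩q⊆p; p∩q⊆q)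
open import Data.Nat using (zero; suc; z≤n; s≤s; s≤s⁻¹; _≤?_; _⊓_; ⌊_/2⌋; ⌈_/2⌉)
open import Data.Nat.Properties
open import Data.Nat.DivMod using (_%_; m≡m%n+[m/n]*n; m%n<n; m/n*n≤m)
open import Data.Nat.Tactic.RingSolver using (solve-∀)
open import Data.Product using (Σ; ∃-syntax; _×_; _,_; proj₂)
open import Data.Sum using (_⊎_; inj₁; inj₂; [_,_])
open import Data.Vec using ([]; _∷_; here; there)
open import Function using (_∘_)
open import Relation.Binary.PropositionalEquality
  using (refl; sym; trans; cong; subst; subst₂; module ≡-Reasoning)
open import Relation.Nullary using (Dec; yes; no; contradiction)

private
  variable
    n : ℕ

∣p∪q∣≡∣p∣+∣q─p∣ : ∀ (p q : Subset n) → ∣ p ∪ q ∣ ≡ ∣ p ∣ + ∣ q ─ p ∣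
∣p∪q∣≡∣p∣+∣q─p∣ []            []            = refl
∣p∪q∣≡∣p∣+∣q─p∣ (inside  ∷ p) (_       ∷ q) = cong suc (∣p∪q∣≡∣p∣+∣q─p∣ p q)
∣p∪q∣≡∣p∣+∣q─p∣ (outside ∷ p) (inside  ∷ q) =
  trans (cong suc (∣p∪q∣≡∣p∣+∣q─p∣ p q)) (sym (+-suc _ _))
∣p∪q∣≡∣p∣+∣q─p∣ (outside ∷ p) (outside ∷ q) = ∣p∪q∣≡∣p∣+∣q─p∣ p q

∣p∣≡∣p∩q∣+∣p─q∣ : ∀ (p q : Subset n) → ∣ p ∣ ≡ ∣ p ∩ q ∣ + ∣ p ─ q ∣
∣p∣≡∣p∩q∣+∣p─q∣ []            []            = refl
∣p∣≡∣p∩q∣+∣p─q∣ (inside  ∷ p) (inside  ∷ q) = cong suc (∣p∣≡∣p∩q∣+∣p─q∣ p q)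
∣p∣≡∣p∩q∣+∣p─q∣ (inside  ∷ p) (outside ∷ q) =
  trans (cong suc (∣p∣≡∣p∩q∣+∣p─q∣ p q)) (sym (+-suc _ _))
∣p∣≡∣p∩q∣+∣p─q∣ (outside ∷ p) (inside  ∷ q) = ∣p∣≡∣p∩q∣+∣p─q∣ p q
∣p∣≡∣p∩q∣+∣p─q∣ (outside ∷ p) (outside ∷ q) = ∣p∣≡∣p∩q∣+∣p─q∣ p q

∣p∪q∣≤∣p∣+∣q∣ : ∀ (p q : Subset n) → ∣ p ∪ q ∣ ≤ ∣ p ∣ + ∣ q ∣
∣p∪q∣≤∣p∣+∣q∣ p q =
  ≤-trans (≤-reflexive (∣p∪q∣≡∣p∣+∣q─p∣ p q)) (+-monoʳ-≤ ∣ p ∣ (∣p─q∣≤∣p∣ q p))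

∣p∣+∣∁p∣≡n : ∀ (p : Subset n) → ∣ p ∣ + ∣ ∁ p ∣ ≡ n
∣p∣+∣∁p∣≡n p = trans (cong (∣ p ∣ +_) (∣∁p∣≡n∸∣p∣ p)) (m+[n∸m]≡n (∣p∣≤n p))

p⊆q∧∣q∣≤∣p∣⇒p≡q : ∀ {p q : Subset n} → p ⊆ q → ∣ q ∣ ≤ ∣ p ∣ → p ≡ q
p⊆q∧∣q∣≤∣p∣⇒p≡q {p = []}          {[]}          _   _ = refl
p⊆q∧∣q∣≤∣p∣⇒p≡q {p = inside  ∷ p} {inside  ∷ q} p⊆q (s≤s ∣q∣≤∣p∣) =
  cong (inside ∷_) (p⊆q∧∣q∣≤∣p∣⇒p≡q (drop-∷-⊆ p⊆q) ∣q∣≤∣p∣)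
p⊆q∧∣q∣≤∣p∣⇒p≡q {p = outside ∷ p} {outside ∷ q} p⊆q ∣q∣≤∣p∣ =
  cong (outside ∷_) (p⊆q∧∣q∣≤∣p∣⇒p≡q (drop-∷-⊆ p⊆q) ∣q∣≤∣p∣)
p⊆q∧∣q∣≤∣p∣⇒p≡q {p = outside ∷ p} {inside  ∷ q} p⊆q ∣q∣<∣p∣ =
  contradiction ∣q∣<∣p∣ (<⇒≱ (s≤s (p⊆q⇒∣p∣≤∣q∣ (drop-∷-⊆ p⊆q))))
p⊆q∧∣q∣≤∣p∣⇒p≡q {p = inside  ∷ p} {outside ∷ q} p⊆q _ = contradiction (p⊆q here) λ ()

∣p∣≡0⇒p≡⊥ : ∀ {p : Subset n} → ∣ p ∣ ≡ 0 → p ≡ ⊥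
∣p∣≡0⇒p≡⊥ {n} ∣p∣≡0 = sym (p⊆q∧∣q∣≤∣p∣⇒p≡q ⊥⊆ (≤-reflexive (trans ∣p∣≡0 (sym (∣⊥∣≡0 n)))))

x∈p─q⇒x∉q : ∀ (p q : Subset n) {x} → x ∈ p ─ q → x ∉ q
x∈p─q⇒x∉q (inside ∷ p) (outside ∷ q) here          ()
x∈p─q⇒x∉q (_      ∷ p) (_       ∷ q) (there x∈p─q) (there x∈q) = x∈p─q⇒x∉q p q x∈p─q x∈q

p∩q≡⊥∧x∈p⇒x∉q : ∀ {p q : Subset n} {x} → p ∩ q ≡ ⊥ → x ∈ p → x ∉ q
p∩q≡⊥∧x∈p⇒x∉q p∩q≡⊥ x∈p x∈q = ∉⊥ (subst (_ ∈_) p∩q≡⊥ (x∈p∩q⁺ (x∈p , x∈q)))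

∣p─r∣≤∣p─q∣+∣q─r∣ : ∀ (p q r : Subset n) → ∣ p ─ r ∣ ≤ ∣ p ─ q ∣ + ∣ q ─ r ∣
∣p─r∣≤∣p─q∣+∣q─r∣ p q r = ≤-trans (p⊆q⇒∣p∣≤∣q∣ p─r⊆) (∣p∪q∣≤∣p∣+∣q∣ (p ─ q) (q ─ r))
  where
  p─r⊆ : p ─ r ⊆ (p ─ q) ∪ (q ─ r)
  p─r⊆ {x} x∈p─r with x ∈? q
  ... | yes x∈q = x∈p∪q⁺ (inj₂ (x∈p∧x∉q⇒x∈p─q x∈q (x∈p─q⇒x∉q p r x∈p─r)))
  ... | no  x∉q = x∈p∪q⁺ (inj₁ (x∈p∧x∉q⇒x∈p─q (p─q⊆p p r x∈p─r) x∉q))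

p∩r≡⊥⇒∣p∩q∣≤∣q─r∣ : ∀ (p q r : Subset n) → p ∩ r ≡ ⊥ → ∣ p ∩ q ∣ ≤ ∣ q ─ r ∣
p∩r≡⊥⇒∣p∩q∣≤∣q─r∣ p q r p∩r≡⊥ = p⊆q⇒∣p∣≤∣q∣ p∩q⊆
  where
  p∩q⊆ : p ∩ q ⊆ q ─ r
  p∩q⊆ x∈p∩q = let x∈p , x∈q = x∈p∩q⁻ p q x∈p∩q in
    x∈p∧x∉q⇒x∈p─q x∈q (p∩q≡⊥∧x∈p⇒x∉q p∩r≡⊥ x∈p)

p∩r≡⊥⇒∣p─q∣≤∣∁[r∪q]∣ : ∀ (p q r : Subset n) → p ∩ r ≡ ⊥ → ∣ p ─ q ∣ ≤ ∣ ∁ (r ∪ q) ∣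
p∩r≡⊥⇒∣p─q∣≤∣∁[r∪q]∣ p q r p∩r≡⊥ = p⊆q⇒∣p∣≤∣q∣ p─q⊆
  where
  p─q⊆ : p ─ q ⊆ ∁ (r ∪ q)
  p─q⊆ x∈p─q = x∉p⇒x∈∁p λ x∈r∪q →
    [ p∩q≡⊥∧x∈p⇒x∉q p∩r≡⊥ (p─q⊆p p q x∈p─q) , x∈p─q⇒x∉q p q x∈p─q ] (x∈p∪q⁻ r q x∈r∪q)

select : (p q : Subset n) (a b c d : ℕ) → Subset n
select []            []            a       b       c       d       = []
select (inside  ∷ p) (inside  ∷ q) zero    b       c       d       = outside ∷ select p q zero b c d
select (inside  ∷ p) (inside  ∷ q) (suc a) b       c       d       = inside  ∷ select p q a b c d
select (inside  ∷ p) (outside ∷ q) a       zero    c       d       = outside ∷ select p q a zero c d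
select (inside  ∷ p) (outside ∷ q) a       (suc b) c       d       = inside  ∷ select p q a b c d
select (outside ∷ p) (inside  ∷ q) a       b       zero    d       = outside ∷ select p q a b zero d
select (outside ∷ p) (inside  ∷ q) a       b       (suc c) d       = inside  ∷ select p q a b c d
select (outside ∷ p) (outside ∷ q) a       b       c       zero    = outside ∷ select p q a b c zero
select (outside ∷ p) (outside ∷ q) a       b       c       (suc d) = inside  ∷ select p q a b c d

select-sizes : ∀ (p q : Subset n) (a b c d : ℕ) →
  a ≤ ∣ p ∩ q ∣ → b ≤ ∣ p ─ q ∣ → c ≤ ∣ q ─ p ∣ → d ≤ ∣ ∁ (p ∪ q) ∣ →
  ∣ select p q a b c d ∣ ≡ a + b + c + d ×
  ∣ select p q a b c d ∩ p ∣ ≡ a + b ×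
  ∣ select p q a b c d ∩ q ∣ ≡ a + c
select-sizes [] [] _ _ _ _ z≤n z≤n z≤n z≤n = refl , refl , refl
select-sizes (inside ∷ p) (inside ∷ q) zero b c d _ b≤ c≤ d≤ =
  select-sizes p q zero b c d z≤n b≤ c≤ d≤
select-sizes (inside ∷ p) (inside ∷ q) (suc a) b c d (s≤s a≤) b≤ c≤ d≤
  with select-sizes p q a b c d a≤ b≤ c≤ d≤
... | e₁ , e₂ , e₃ = cong suc e₁ , cong suc e₂ , cong suc e₃
select-sizes (inside ∷ p) (outside ∷ q) a zero c d a≤ _ c≤ d≤ =
  select-sizes p q a zero c d a≤ z≤n c≤ d≤
select-sizes (inside ∷ p) (outside ∷ q) a (suc b) c d a≤ (s≤s b≤) c≤ d≤
  with select-sizes p q a b c d a≤ b≤ c≤ d≤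
... | e₁ , e₂ , e₃ =
  trans (cong suc e₁) (cong (λ m → m + c + d) (sym (+-suc a b))) ,
  trans (cong suc e₂) (sym (+-suc a b)) ,
  e₃
select-sizes (outside ∷ p) (inside ∷ q) a b zero d a≤ b≤ _ d≤ =
  select-sizes p q a b zero d a≤ b≤ z≤n d≤
select-sizes (outside ∷ p) (inside ∷ q) a b (suc c) d a≤ b≤ (s≤s c≤) d≤
  with select-sizes p q a b c d a≤ b≤ c≤ d≤
... | e₁ , e₂ , e₃ =
  trans (cong suc e₁) (cong (_+ d) (sym (+-suc (a + b) c))) ,
  e₂ ,
  trans (cong suc e₃) (sym (+-suc a c))
select-sizes (outside ∷ p) (outside ∷ q) a b c zero a≤ b≤ c≤ _ =
  select-sizes p q a b c zero a≤ b≤ c≤ z≤n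
select-sizes (outside ∷ p) (outside ∷ q) a b c (suc d) a≤ b≤ c≤ (s≤s d≤)
  with select-sizes p q a b c d a≤ b≤ c≤ d≤
... | e₁ , e₂ , e₃ = trans (cong suc e₁) (sym (+-suc (a + b + c) d)) , e₂ , e₃

double : ℕ → ℕ
double zero    = zero
double (suc j) = suc (suc (double j))

double≡2* : ∀ j → double j ≡ 2 * j
double≡2* zero    = refl
double≡2* (suc j) = trans (cong (2 +_) (double≡2* j)) (sym (*-suc 2 j))

m<double[i]⇒parity : ∀ {m} i → m < double i →
  ∃[ j ] j < i × (m ≡ double j ⊎ m ≡ suc (double j))
m<double[i]⇒parity {zero}        (suc i) _ = 0 , s≤s z≤n , inj₁ refl
m<double[i]⇒parity {suc zero}    (suc i) _ = 0 , s≤s z≤n , inj₂ refl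
m<double[i]⇒parity {suc (suc m)} (suc i) (s≤s (s≤s m<double[i]))
  with m<double[i]⇒parity i m<double[i]
... | j , j<i , inj₁ refl = suc j , s≤s j<i , inj₁ refl
... | j , j<i , inj₂ refl = suc j , s≤s j<i , inj₂ refl

⌈n/2⌉≤1+⌊n/2⌋ : ∀ n → ⌈ n /2⌉ ≤ suc ⌊ n /2⌋
⌈n/2⌉≤1+⌊n/2⌋ zero          = z≤n
⌈n/2⌉≤1+⌊n/2⌋ (suc zero)    = s≤s z≤n
⌈n/2⌉≤1+⌊n/2⌋ (suc (suc n)) = s≤s (⌈n/2⌉≤1+⌊n/2⌋ n)

a≤ceilDiv[a,d]*d : ∀ a {d} → 0 < d → a ≤ ceilDiv a d * d
a≤ceilDiv[a,d]*d a {suc b} _ = +-cancelʳ-≤ b a (ceilDiv a (suc b) * suc b) (begin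
  a + b                              ≡⟨ m≡m%n+[m/n]*n (a + b) (suc b) ⟩
  (a + b) % suc b + ceilDiv a (suc b) * suc b ≤⟨ +-monoˡ-≤ _ (≤-pred (m%n<n (a + b) (suc b))) ⟩
  b + ceilDiv a (suc b) * suc b      ≡⟨ +-comm b _ ⟩
  ceilDiv a (suc b) * suc b + b      ∎)
  where open ≤-Reasoning

m<ceilDiv[a,d]⇒m*d<a : ∀ a {d} m → 0 < d → m < ceilDiv a d → m * d < a
m<ceilDiv[a,d]⇒m*d<a a {suc b} m _ m<c = +-cancelˡ-< b (m * suc b) a (begin-strict
  b + m * suc b             <⟨ n<1+n _ ⟩
  suc m * suc b             ≤⟨ *-monoˡ-≤ (suc b) m<c ⟩
  ceilDiv a (suc b) * suc b ≤⟨ m/n*n≤m (a + b) (suc b) ⟩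
  a + b                     ≡⟨ +-comm a b ⟩
  b + a                     ∎)
  where open ≤-Reasoning

Walk₀⇒≡ : ∀ {V : Set} {E : V → V → Set} {x y} → Walk E x y 0 → x ≡ y
Walk₀⇒≡ here = refl

Walk₁⇒E : ∀ {V : Set} {E : V → V → Set} {x y} → Walk E x y 1 → E x y
Walk₁⇒E (step e here) = e

module Kneser (k r : ℕ) where

  V : Set
  V = Vertex (2 * k + r) k

  Adj : V → V → Set
  Adj = KneserAdj {2 * k + r} {k}

  shared : V → V → ℕ
  shared X Y = ∣ proj₁ X ∩ proj₁ Y ∣

  gap : V → V → ℕ
  gap X Y = ∣ proj₁ X ─ proj₁ Y ∣

  shared-sym : ∀ X Y → shared X Y ≡ shared Y X
  shared-sym X Y = cong ∣_∣ (∩-comm (proj₁ X) (proj₁ Y))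

  shared+gap≡k : ∀ X Y → shared X Y + gap X Y ≡ k
  shared+gap≡k X Y = trans (sym (∣p∣≡∣p∩q∣+∣p─q∣ (proj₁ X) (proj₁ Y))) (proj₂ X)

  shared+u≡k⇒gap≡u : ∀ X Y {u} → shared X Y + u ≡ k → gap X Y ≡ u
  shared+u≡k⇒gap≡u X Y s+u≡k = +-cancelˡ-≡ (shared X Y) _ _ (trans (shared+gap≡k X Y) (sym s+u≡k))

  gap≡k∸shared : ∀ X Y → gap X Y ≡ k ∸ shared X Y
  gap≡k∸shared X Y =
    trans (sym (m+n∸m≡n (shared X Y) (gap X Y))) (cong (_∸ shared X Y) (shared+gap≡k X Y))

  gap-sym : ∀ X Y → gap X Y ≡ gap Y X
  gap-sym X Y = shared+u≡k⇒gap≡u X Y (trans (cong (_+ gap Y X) (shared-sym X Y)) (shared+gap≡k Y X))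

  gap-self : ∀ X → gap X X ≡ 0
  gap-self X =
    shared+u≡k⇒gap≡u X X (trans (+-identityʳ _) (trans (cong ∣_∣ (∩-idem (proj₁ X))) (proj₂ X)))

  gap≤k : ∀ X Y → gap X Y ≤ k
  gap≤k X Y = ≤-trans (m≤n+m _ _) (≤-reflexive (shared+gap≡k X Y))

  gap-triangle : ∀ X Y Z → gap X Z ≤ gap X Y + gap Y Z
  gap-triangle X Y Z = ∣p─r∣≤∣p─q∣+∣q─r∣ (proj₁ X) (proj₁ Y) (proj₁ Z)

  proj₁-injective : ∀ {X Y : V} → proj₁ X ≡ proj₁ Y → X ≡ Y
  proj₁-injective {X , ∣X∣≡k} {.X , ∣Y∣≡k} refl = cong (X ,_) (≡-irrelevant ∣X∣≡k ∣Y∣≡k)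

  gap≡0⇒≡ : ∀ X Y → gap X Y ≡ 0 → X ≡ Y
  gap≡0⇒≡ X Y gap≡0 = proj₁-injective (trans (sym X∩Y≡X) X∩Y≡Y)
    where
    k≤shared : k ≤ shared X Y
    k≤shared = ≤-reflexive (trans (sym (shared+gap≡k X Y))
                                  (trans (cong (shared X Y +_) gap≡0) (+-identityʳ _)))
    X∩Y≡X : proj₁ X ∩ proj₁ Y ≡ proj₁ X
    X∩Y≡X = p⊆q∧∣q∣≤∣p∣⇒p≡q (p∩q⊆p _ _) (subst (_≤ shared X Y) (sym (proj₂ X)) k≤shared)
    X∩Y≡Y : proj₁ X ∩ proj₁ Y ≡ proj₁ Y
    X∩Y≡Y = p⊆q∧∣q∣≤∣p∣⇒p≡q (p∩q⊆q _ _) (subst (_≤ shared X Y) (sym (proj₂ Y)) k≤shared)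

  shared≡0⇒Adj : ∀ X Y → shared X Y ≡ 0 → Adj X Y
  shared≡0⇒Adj _ _ = ∣p∣≡0⇒p≡⊥

  ∣∁[X∪Y]∣≡r+shared : ∀ X Y → ∣ ∁ (proj₁ X ∪ proj₁ Y) ∣ ≡ r + shared X Y
  ∣∁[X∪Y]∣≡r+shared X Y =
    cancel (trans (cong (_+ gap Y X) (shared-sym X Y)) (shared+gap≡k Y X))
           (trans (cong (_+ ∣ ∁ X∪Y ∣) (sym ∣X∪Y∣≡k+gap)) (∣p∣+∣∁p∣≡n X∪Y))
    where
    X∪Y : Subset (2 * k + r)
    X∪Y = proj₁ X ∪ proj₁ Y
    ∣X∪Y∣≡k+gap : ∣ X∪Y ∣ ≡ k + gap Y X
    ∣X∪Y∣≡k+gap = trans (∣p∪q∣≡∣p∣+∣q─p∣ (proj₁ X) (proj₁ Y)) (cong (_+ gap Y X) (proj₂ X))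
    cancel : ∀ {s g c} → s + g ≡ k → (k + g) + c ≡ 2 * k + r → c ≡ r + s
    cancel {s} {g} {c} refl eq = +-cancelˡ-≡ (s + g + g) c (r + s) (trans eq (expand s g r))
      where
      expand : ∀ s g r → 2 * (s + g) + r ≡ (s + g + g) + (r + s)
      expand = solve-∀

  Adj⇒shared≤gap : ∀ X W → Adj X W → ∀ Y → shared X Y ≤ gap W Y
  Adj⇒shared≤gap X W X∩W≡⊥ Y =
    ≤-trans (p∩r≡⊥⇒∣p∩q∣≤∣q─r∣ (proj₁ X) (proj₁ Y) (proj₁ W) X∩W≡⊥) (≤-reflexive (gap-sym Y W))

  Adj⇒gap≤r+shared : ∀ X W → Adj X W → ∀ Y → gap X Y ≤ r + shared W Y
  Adj⇒gap≤r+shared X W X∩W≡⊥ Y =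
    ≤-trans (p∩r≡⊥⇒∣p─q∣≤∣∁[r∪q]∣ (proj₁ X) (proj₁ Y) (proj₁ W) X∩W≡⊥)
            (≤-reflexive (∣∁[X∪Y]∣≡r+shared W Y))

  vertexWithShared : ∀ X Y {a b c d} →
    a ≤ shared X Y → b ≤ gap X Y → c ≤ gap Y X → d ≤ r + shared X Y → a + b + c + d ≡ k →
    Σ V λ C → shared C X ≡ a + b × shared C Y ≡ a + c
  vertexWithShared X Y {a} {b} {c} {d} a≤ b≤ c≤ d≤ a+b+c+d≡k =
    let ∣C∣≡ , ∣C∩X∣≡ , ∣C∩Y∣≡ = select-sizes (proj₁ X) (proj₁ Y) a b c d a≤ b≤ c≤
                                   (subst (d ≤_) (sym (∣∁[X∪Y]∣≡r+shared X Y)) d≤)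
    in (select (proj₁ X) (proj₁ Y) a b c d , trans ∣C∣≡ a+b+c+d≡k) , ∣C∩X∣≡ , ∣C∩Y∣≡

  splitGap : ∀ X Y {u v} → u + v ≡ gap X Y → Σ V λ C → gap X C ≡ u × gap C Y ≡ v
  splitGap X Y {u} {v} u+v≡gap =
    let C , C∩X , C∩Y = vertexWithShared X Y {s} {v} {u} {0} ≤-refl
                          (≤-trans (m≤n+m v u) (≤-reflexive u+v≡gap))
                          (≤-trans (m≤m+n u v) (≤-reflexive (trans u+v≡gap (gap-sym X Y))))
                          z≤n (trans (+-identityʳ _) s+v+u≡k)
    in C , shared+u≡k⇒gap≡u X C (trans (cong (_+ u) (trans (shared-sym X C) C∩X)) s+v+u≡k)
         , shared+u≡k⇒gap≡u C Y (trans (cong (_+ v) C∩Y) (trans (+-assoc s u v) s+[u+v]≡k))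
    where
    s : ℕ
    s = shared X Y
    s+[u+v]≡k : s + (u + v) ≡ k
    s+[u+v]≡k = trans (cong (s +_) u+v≡gap) (shared+gap≡k X Y)
    s+v+u≡k : s + v + u ≡ k
    s+v+u≡k = trans (+-assoc s v u) (trans (cong (s +_) (+-comm v u)) s+[u+v]≡k)

  equidistantVertex : ∀ X Y {A h} → h ≤ A → h ≤ gap X Y → gap X Y ≤ A + h → A + h ≤ k →
    A ≤ h + (r + shared X Y) → Σ V λ C → gap X C ≡ A × gap C Y ≡ A
  equidistantVertex X Y {A} {h} h≤A h≤gap gap≤A+h A+h≤k A≤h+r+s =
    let C , C∩X , C∩Y = vertexWithShared X Y {a} {h} {h} {d} a≤s h≤gap
                          (subst (h ≤_) (gap-sym X Y) h≤gap) d≤r+s a+h+h+d≡k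
    in C , shared+u≡k⇒gap≡u X C (trans (cong (_+ A) (trans (shared-sym X C) C∩X)) a+h+A≡k)
         , shared+u≡k⇒gap≡u C Y (trans (cong (_+ A) C∩Y) a+h+A≡k)
    where
    s d a : ℕ
    s = shared X Y
    d = A ∸ h
    a = k ∸ (A + h)
    h+d≡A : h + d ≡ A
    h+d≡A = m+[n∸m]≡n h≤A
    A+h+a≡k : A + h + a ≡ k
    A+h+a≡k = m+[n∸m]≡n A+h≤k
    a+h+A≡k : a + h + A ≡ k
    a+h+A≡k = trans (reverse a h A) A+h+a≡k
      where
      reverse : ∀ a h A → a + h + A ≡ A + h + a
      reverse = solve-∀
    a+h+h+d≡k : a + h + h + d ≡ k
    a+h+h+d≡k = trans (regroup a h d) (trans (cong (λ m → a + h + m) h+d≡A) a+h+A≡k)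
      where
      regroup : ∀ a h d → a + h + h + d ≡ a + h + (h + d)
      regroup = solve-∀
    a≤s : a ≤ s
    a≤s = +-cancelˡ-≤ (A + h) a s (begin
      A + h + a        ≡⟨ A+h+a≡k ⟩
      k                ≡⟨ shared+gap≡k X Y ⟨
      s + gap X Y      ≤⟨ +-monoʳ-≤ s gap≤A+h ⟩
      s + (A + h)      ≡⟨ +-comm s (A + h) ⟩
      A + h + s        ∎)
      where open ≤-Reasoning
    d≤r+s : d ≤ r + s
    d≤r+s = +-cancelˡ-≤ h d (r + s) (≤-trans (≤-reflexive h+d≡A) A≤h+r+s)

  commonNeighbour : ∀ X Y → gap X Y ≤ r → Σ V λ Z → Adj X Z × Adj Z Y
  commonNeighbour X Y gap≤r =
    let Z , Z∩X≡0 , Z∩Y≡0 = vertexWithShared X Y {0} {0} {0} {k} z≤n z≤n z≤n k≤r+s refl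
    in Z , shared≡0⇒Adj X Z (trans (shared-sym X Z) Z∩X≡0) , shared≡0⇒Adj Z Y Z∩Y≡0
    where
    k≤r+s : k ≤ r + shared X Y
    k≤r+s = begin
      k                       ≡⟨ shared+gap≡k X Y ⟨
      shared X Y + gap X Y    ≤⟨ +-monoʳ-≤ (shared X Y) gap≤r ⟩
      shared X Y + r          ≡⟨ +-comm (shared X Y) r ⟩
      r + shared X Y          ∎
      where open ≤-Reasoning

  neighbourWithGapShared : ∀ X Y → Σ V λ Z → Adj X Z × gap Z Y ≡ shared X Y
  neighbourWithGapShared X Y =
    let Z , Z∩X≡0 , Z∩Y≡g = vertexWithShared X Y {0} {0} {gap Y X} {shared X Y} z≤n z≤n ≤-refl
                              (m≤n+m (shared X Y) r) g+s≡k
    in Z , shared≡0⇒Adj X Z (trans (shared-sym X Z) Z∩X≡0)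
         , shared+u≡k⇒gap≡u Z Y (trans (cong (_+ shared X Y) Z∩Y≡g) g+s≡k)
    where
    g+s≡k : gap Y X + shared X Y ≡ k
    g+s≡k = trans (+-comm (gap Y X) _)
                  (trans (cong (_+ gap Y X) (shared-sym X Y)) (shared+gap≡k Y X))

  evenWalk⇒gap≤ : ∀ j {X Y} → Walk Adj X Y (double j) → gap X Y ≤ r * j
  oddWalk⇒shared≤ : ∀ j {X Y} → Walk Adj X Y (suc (double j)) → shared X Y ≤ r * j
  evenWalk⇒gap≤ zero {X} here = ≤-reflexive (trans (gap-self X) (sym (*-zeroʳ r)))
  evenWalk⇒gap≤ (suc j) {X} {Y} (step {y = W} X~W W⋯Y) = begin
    gap X Y             ≤⟨ Adj⇒gap≤r+shared X W X~W Y ⟩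
    r + shared W Y      ≤⟨ +-monoʳ-≤ r (oddWalk⇒shared≤ j W⋯Y) ⟩
    r + r * j           ≡⟨ *-suc r j ⟨
    r * suc j           ∎
    where open ≤-Reasoning
  oddWalk⇒shared≤ j {X} {Y} (step {y = W} X~W W⋯Y) =
    ≤-trans (Adj⇒shared≤gap X W X~W Y) (evenWalk⇒gap≤ j W⋯Y)

  gap≤⇒evenWalk : ∀ j X Y → gap X Y ≤ r * j → Walk Adj X Y (double j)
  gap≤⇒evenWalk zero X Y gap≤r*0 =
    subst (λ Z → Walk Adj X Z 0)
          (gap≡0⇒≡ X Y (n≤0⇒n≡0 (≤-trans gap≤r*0 (≤-reflexive (*-zeroʳ r)))))
          here
  gap≤⇒evenWalk (suc j) X Y gap≤r*[1+j] =
    let W , gapXW , gapWY = splitGap X Y (trans (+-comm (g ∸ r * j) _) (m⊓n+n∸m≡n (r * j) g))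
        Z , X~Z , Z~W     = commonNeighbour X W (subst (_≤ r) (sym gapXW) g∸rj≤r)
    in step {y = Z} X~Z
         (step Z~W (gap≤⇒evenWalk j W Y (subst (_≤ r * j) (sym gapWY) (m⊓n≤m (r * j) g))))
    where
    g : ℕ
    g = gap X Y
    g∸rj≤r : g ∸ r * j ≤ r
    g∸rj≤r = m≤n+o⇒m∸n≤o g (r * j) (subst (g ≤_) (trans (*-suc r j) (+-comm r (r * j))) gap≤r*[1+j])

  shared≤⇒oddWalk : ∀ j X Y → shared X Y ≤ r * j → Walk Adj X Y (suc (double j))
  shared≤⇒oddWalk j X Y s≤rj =
    let Z , X~Z , gapZY≡s = neighbourWithGapShared X Y
    in step X~Z (gap≤⇒evenWalk j Z Y (subst (_≤ r * j) (sym gapZY≡s) s≤rj))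

  module ExactDistance (p₀ : ℕ) (1≤r : 1 ≤ r) where

    p : ℕ
    p = suc p₀

    q : ℕ
    q = r * p₀

    M : ℕ
    M = r * p

    G : V → V → Set
    G = ExactDist Adj (2 * p)

    q<M : q < M
    q<M = subst (q <_) (sym (*-suc r p₀)) (+-monoˡ-≤ q 1≤r)

    0<M : 0 < M
    0<M = *-mono-≤ 1≤r (s≤s z≤n)

    G-intro : ∀ X Y {A} → gap X Y ≡ A → q < A → A + q < k → A ≤ M → G X Y
    G-intro X Y {A} gap≡A q<A A+q<k A≤M =
      subst (Dist Adj X Y) (double≡2* p)
            (gap≤⇒evenWalk p X Y (subst (_≤ M) (sym gap≡A) A≤M) , noShorter)
      where
      q<shared : q < shared X Y
      q<shared = +-cancelʳ-< A q (shared X Y) (subst₂ _<_ (+-comm A q)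
        (sym (trans (cong (shared X Y +_) (sym gap≡A)) (shared+gap≡k X Y))) A+q<k)
      noShorter : ∀ m → m < double p → ¬ Walk Adj X Y m
      noShorter m m<2p w with m<double[i]⇒parity p m<2p
      ... | j , j<p , inj₁ refl =
        <⇒≱ q<A (subst (_≤ q) gap≡A (≤-trans (evenWalk⇒gap≤ j w) (*-monoʳ-≤ r (≤-pred j<p))))
      ... | j , j<p , inj₂ refl =
        <⇒≱ q<shared (≤-trans (oddWalk⇒shared≤ j w) (*-monoʳ-≤ r (≤-pred j<p)))

    G⇒gap≤M : ∀ {X Y} → G X Y → gap X Y ≤ M
    G⇒gap≤M {X} {Y} X~Y = evenWalk⇒gap≤ p (subst (Walk Adj X Y) (sym (double≡2* p)) (proj₁ X~Y))

    G-walk⇒gap≤ : ∀ m {X Y} → Walk G X Y m → gap X Y ≤ m * M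
    G-walk⇒gap≤ zero    {X}     here = ≤-reflexive (gap-self X)
    G-walk⇒gap≤ (suc m) {X} {Y} (step {y = W} X~W W⋯Y) =
      ≤-trans (gap-triangle X W Y) (+-mono-≤ (G⇒gap≤M X~W) (G-walk⇒gap≤ m W⋯Y))

    2p≤dist⇒2[1+q]≤k : ∀ {x y D} → Dist Adj x y D → 2 * p ≤ D → suc q + suc q ≤ k
    2p≤dist⇒2[1+q]≤k {x} {y} {D} (_ , noShorter) 2p≤D =
      ≤-trans (+-mono-≤ q<shared q<gap) (≤-reflexive (shared+gap≡k x y))
      where
      2+double[p₀]≤D : suc (suc (double p₀)) ≤ D
      2+double[p₀]≤D = subst (_≤ D) (sym (double≡2* p)) 2p≤D
      q<shared : q < shared x y
      q<shared = ≰⇒> λ s≤q →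
        noShorter _ 2+double[p₀]≤D (shared≤⇒oddWalk p₀ x y s≤q)
      q<gap : q < gap x y
      q<gap = ≰⇒> λ g≤q →
        noShorter _ (<-trans (n<1+n _) 2+double[p₀]≤D) (gap≤⇒evenWalk p₀ x y g≤q)

    module _ (2[1+q]≤k : suc q + suc q ≤ k) where

      twoStep : ∀ X Y → gap X Y ≤ M + M → Walk G X Y 2
      twoStep X Y t≤M+M = byCases (h′ ≤? suc q)
        where
        s t h h′ : ℕ
        s  = shared X Y
        t  = gap X Y
        h  = ⌊ t /2⌋
        h′ = ⌈ t /2⌉
        h+h′≡t : h + h′ ≡ t
        h+h′≡t = ⌊n/2⌋+⌈n/2⌉≡n t
        h≤h′ : h ≤ h′
        h≤h′ = ⌊n/2⌋≤⌈n/2⌉ t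
        h′≤1+h : h′ ≤ suc h
        h′≤1+h = ⌈n/2⌉≤1+⌊n/2⌋ t
        h≤t : h ≤ t
        h≤t = ≤-trans (m≤m+n h h′) (≤-reflexive h+h′≡t)

        via : ∀ A → h ≤ A → t ≤ A + h → A + h ≤ k → A ≤ h + (r + s) →
              q < A → A + q < k → A ≤ M → Walk G X Y 2
        via A h≤A t≤A+h A+h≤k A≤h+r+s q<A A+q<k A≤M =
          let C , gapXC , gapCY = equidistantVertex X Y h≤A h≤t t≤A+h A+h≤k A≤h+r+s
          in step {y = C} (G-intro X C gapXC q<A A+q<k A≤M)
               (step (G-intro C Y gapCY q<A A+q<k A≤M) here)

        byCases : Dec (h′ ≤ suc q) → Walk G X Y 2
        byCases (yes h′≤1+q) =
          via (suc q) h≤1+q t≤1+q+h 1+q+h≤k 1+q≤h+r+s (n<1+n q) 1+q+q<k q<M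
          where
          h≤1+q : h ≤ suc q
          h≤1+q = ≤-trans h≤h′ h′≤1+q
          t≤1+q+h : t ≤ suc q + h
          t≤1+q+h = begin
            t          ≡⟨ h+h′≡t ⟨
            h + h′     ≤⟨ +-monoʳ-≤ h h′≤1+q ⟩
            h + suc q  ≡⟨ +-comm h (suc q) ⟩
            suc q + h  ∎
            where open ≤-Reasoning
          1+q+h≤k : suc q + h ≤ k
          1+q+h≤k = ≤-trans (+-monoʳ-≤ (suc q) h≤1+q) 2[1+q]≤k
          1+q≤s+h : suc q ≤ s + h
          1+q≤s+h = +-cancelʳ-≤ h′ (suc q) (s + h) (begin
            suc q + h′     ≤⟨ +-monoʳ-≤ (suc q) h′≤1+q ⟩
            suc q + suc q  ≤⟨ 2[1+q]≤k ⟩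
            k              ≡⟨ shared+gap≡k X Y ⟨
            s + t          ≡⟨ cong (s +_) h+h′≡t ⟨
            s + (h + h′)   ≡⟨ +-assoc s h h′ ⟨
            s + h + h′     ∎)
            where open ≤-Reasoning
          1+q+q<k : suc q + q < k
          1+q+q<k = <-≤-trans (+-monoʳ-< (suc q) (n<1+n q)) 2[1+q]≤k
          1+q≤h+r+s : suc q ≤ h + (r + s)
          1+q≤h+r+s = ≤-trans 1+q≤s+h (≤-trans (≤-reflexive (+-comm s h)) (+-monoʳ-≤ h (m≤n+m s r)))
        byCases (no h′≰1+q) = via h′ h≤h′ t≤h′+h h′+h≤k h′≤h+r+s q<h′ h′+q<k h′≤M
          where
          1+q<h′ : suc q < h′
          1+q<h′ = ≰⇒> h′≰1+q
          q<h′ : q < h′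
          q<h′ = <-trans (n<1+n q) 1+q<h′
          q<h : q < h
          q<h = s≤s⁻¹ (≤-trans 1+q<h′ h′≤1+h)
          t≤h′+h : t ≤ h′ + h
          t≤h′+h = ≤-reflexive (trans (sym h+h′≡t) (+-comm h h′))
          h′+h≤k : h′ + h ≤ k
          h′+h≤k = ≤-trans (≤-reflexive (trans (+-comm h′ h) h+h′≡t)) (gap≤k X Y)
          h′≤h+r+s : h′ ≤ h + (r + s)
          h′≤h+r+s = ≤-trans h′≤1+h
            (≤-trans (≤-reflexive (+-comm 1 h)) (+-monoʳ-≤ h (≤-trans 1≤r (m≤m+n r s))))
          h′+q<k : h′ + q < k
          h′+q<k = <-≤-trans (+-monoʳ-< h′ q<h) h′+h≤k
          h′≤M : h′ ≤ M
          h′≤M = ≮⇒≥ λ M<h′ →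
            <⇒≱ (+-mono-≤-< (s≤s⁻¹ (≤-trans M<h′ h′≤1+h)) M<h′) (≤-trans (≤-reflexive h+h′≡t) t≤M+M)

      stepToward : ∀ X Y → M + M < gap X Y → Σ V λ C → G X C × M + gap C Y ≡ gap X Y
      stepToward X Y 2M<t =
        let v , M+v≡t         = m≤n⇒∃[o]m+o≡n M≤t
            C , gapXC , gapCY = splitGap X Y M+v≡t
        in C , G-intro X C gapXC q<M M+q<k ≤-refl , trans (cong (M +_) gapCY) M+v≡t
        where
        M≤t : M ≤ gap X Y
        M≤t = ≤-trans (m≤m+n M M) (<⇒≤ 2M<t)
        M+q<k : M + q < k
        M+q<k = <-trans (+-monoʳ-< M q<M) (<-≤-trans 2M<t (gap≤k X Y))

      longWalk : ∀ l X Y → (2 + l) * M < gap X Y → gap X Y ≤ (3 + l) * M → Walk G X Y (3 + l)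
      longWalk l X Y lo hi =
        let C , X~C , M+gapCY≡t = stepToward X Y (≤-<-trans (+-monoʳ-≤ M (m≤m+n M (l * M))) lo)
        in step X~C (rest l C (+-cancelˡ-< M _ _ (subst ((2 + l) * M <_) (sym M+gapCY≡t) lo))
                              (+-cancelˡ-≤ M _ _ (subst (_≤ (3 + l) * M) (sym M+gapCY≡t) hi)))
        where
        rest : ∀ l C → (1 + l) * M < gap C Y → gap C Y ≤ (2 + l) * M → Walk G C Y (2 + l)
        rest zero    C _  hi = twoStep C Y (subst (gap C Y ≤_) (cong (M +_) (+-identityʳ M)) hi)
        rest (suc l) C lo hi = longWalk l C Y lo hi

      G-distance : ∀ A B → A ≢ B → ¬ G A B → Dist G A B (2 ⊔ ceilDiv (gap A B) M)
      G-distance A B A≢B A≁B = byCases (c ≤? 2)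
        where
        c : ℕ
        c = ceilDiv (gap A B) M
        gap≤c*M : gap A B ≤ c * M
        gap≤c*M = a≤ceilDiv[a,d]*d (gap A B) 0<M
        noWalkShorterThan2 : ∀ m → m < 2 → ¬ Walk G A B m
        noWalkShorterThan2 zero          _ = A≢B ∘ Walk₀⇒≡
        noWalkShorterThan2 (suc zero)    _ = A≁B ∘ Walk₁⇒E
        noWalkShorterThan2 (suc (suc _)) (s≤s (s≤s ()))
        noWalkShorterThanC : ∀ m → m < c → ¬ Walk G A B m
        noWalkShorterThanC m m<c w =
          <⇒≱ (m<ceilDiv[a,d]⇒m*d<a (gap A B) m 0<M m<c) (G-walk⇒gap≤ m w)

        byCases : Dec (c ≤ 2) → Dist G A B (2 ⊔ c)
        byCases (yes c≤2) =
          subst (Dist G A B) (sym (m≥n⇒m⊔n≡m c≤2)) (twoStep A B gap≤M+M , noWalkShorterThan2)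
          where
          gap≤M+M : gap A B ≤ M + M
          gap≤M+M = ≤-trans gap≤c*M
            (≤-trans (*-monoˡ-≤ M c≤2) (≤-reflexive (cong (M +_) (+-identityʳ M))))
        byCases (no c≰2) =
          let l , 3+l≡c = m≤n⇒∃[o]m+o≡n (≰⇒> c≰2)
              walk = longWalk l A B
                       (m<ceilDiv[a,d]⇒m*d<a (gap A B) (2 + l) 0<M (subst (2 + l <_) 3+l≡c ≤-refl))
                       (subst (λ m → gap A B ≤ m * M) (sym 3+l≡c) gap≤c*M)
          in subst (Dist G A B) (sym (m≤n⇒m⊔n≡n (<⇒≤ (≰⇒> c≰2))))
               (subst (Walk G A B) 3+l≡c walk , noWalkShorterThanC)

mainTheorem2 : (k r D p : ℕ) → 2 ≤ k → 1 ≤ r → r < k ∸ 1 →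
    IsDiameter (KneserAdj {2 * k + r} {k}) D →
    1 ≤ p → 2 * p ≤ D →
    (A B : Vertex (2 * k + r) k) → A ≢ B →
    ¬ ExactDist (KneserAdj {2 * k + r} {k}) (2 * p) A B →
    Dist (ExactDist (KneserAdj {2 * k + r} {k}) (2 * p)) A B
      (2 ⊔ ceilDiv (k ∸ ∣ proj₁ A ∩ proj₁ B ∣) (r * p))
mainTheorem2 k r D (suc p₀) _ 1≤r _ (_ , x , y , dist[x,y]≡D) _ 2p≤D A B A≢B A≁B =
  subst (λ t → Dist G A B (2 ⊔ ceilDiv t M)) (gap≡k∸shared A B)
        (G-distance (2p≤dist⇒2[1+q]≤k dist[x,y]≡D 2p≤D) A B A≢B A≁B)
  where
  open Kneser k r
  open ExactDistance p₀ 1≤r
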